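{- Let $G=(V,E)$ be an unweighted graph with $V=\{v_1,\dots,v_n\}$, $n\ge1$. Let $G'=(V',E')$ with $V'=V\cup\{u^*,u_1,\dots,u_n\}$ (new vertices) and $E'=E\cup\{\{u^*,u_i\}:i\in[n]\}\cup\{\{u^*,v_1\}\}$. Let $\mathcal{D}^*$ be a probability distribution over subsets of $V'$ maximizing $\mu(\cdot,1,G')$, and let $S^*_{mc}$ be a maximum cut of $G$. Then $\mu(\mathcal{D}^*,1,G')=C_{S^*_{mc},G}$.
   Context: For a graph $H$ and $S\subseteq V(H)$, $C_{S,H}$ is the number of edges of $H$ with exactly one endpoint in $S$; $H-F$ deletes the vertices of $F$ and incident edges. For a distribution $\mathcal{D}$ over subsets of $V(H)$, $\mu(\mathcal{D},1,H)=\min_{v\in V(H)}\mathbb{E}_{S\sim\mathcal{D}}[C_{S-\{v\},H-\{v\}}]$.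
   Formalization: The distribution $\mathcal{D}^*$, and every distribution it is compared against in maximizing $\mu(\cdot,1,G')$, only takes rational probabilities. -}

module Defs where

open import Data.Bool using (Bool; true; false; _∧_; _xor_; if_then_else_; not)
open import Data.Nat as ℕ using (ℕ; zero; suc; _<ᵇ_)
import Data.Nat.Properties as ℕP
open import Data.Integer using (+_)
open import Data.Fin using (Fin; zero; suc; toℕ; splitAt; _≟_)
open import Data.Sum using (inj₁; inj₂)
open import Data.Product using (_×_; _,_; proj₁; proj₂)
open import Data.List using (List; []; _∷_; foldr; map)
open import Data.List.Relation.Unary.All using (All)
open import Data.Rational using (ℚ; 0ℚ; 1ℚ; _+_; _*_; _⊓_; _≤_; _/_)
open import Relation.Nullary.Decidable using (⌊_⌋)
open import Relation.Binary.PropositionalEquality using (_≡_; refl)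

record Graph (m : ℕ) : Set where
  field
    adj    : Fin m → Fin m → Bool
    sym    : ∀ x y → adj x y ≡ adj y x
    irrefl : ∀ x → adj x x ≡ false
open Graph public

VSubset : ℕ → Set
VSubset m = Fin m → Bool

sumFin : ∀ {m} → (Fin m → ℕ) → ℕ
sumFin {zero}  f = 0
sumFin {suc m} f = f zero ℕ.+ sumFin (λ i → f (suc i))

-- Number of edges of the induced subgraph H[W] with exactly one endpoint in S.
-- Each unordered edge {x,y} is counted once (as x < y).
cutIn : ∀ {m} → Graph m → VSubset m → VSubset m → ℕ
cutIn H W S = sumFin λ x → sumFin λ y →
  if (toℕ x <ᵇ toℕ y) ∧ W x ∧ W y ∧ adj H x y ∧ (S x xor S y) then 1 else 0

C : ∀ {m} → VSubset m → Graph m → ℕ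
C S H = cutIn H (λ _ → true) S

-- C_{S - {v}, H - {v}}: the graph H - {v} is the subgraph induced on V(H) \ {v},
-- and S - {v} is S with v removed.
Cdel : ∀ {m} → VSubset m → Graph m → Fin m → ℕ
Cdel S H v = cutIn H (λ x → not ⌊ x ≟ v ⌋) (λ x → S x ∧ not ⌊ x ≟ v ⌋)

record Distribution (m : ℕ) : Set where
  field
    support  : List (VSubset m × ℚ)
    nonneg   : All (λ p → 0ℚ ≤ proj₂ p) support
    sumToOne : foldr (λ p acc → proj₂ p + acc) 0ℚ support ≡ 1ℚ
open Distribution public

toℚ : ℕ → ℚ
toℚ k = (+ k) / 1

expect : ∀ {m} → Distribution m → (VSubset m → ℕ) → ℚ
expect D f = foldr (λ p acc → proj₂ p * toℚ (f (proj₁ p)) + acc) 0ℚ (support D)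

minFin : ∀ {m} → (Fin (suc m) → ℚ) → ℚ
minFin {zero}  f = f zero
minFin {suc m} f = f zero ⊓ minFin (λ i → f (suc i))

μ₁ : ∀ {m} → Distribution (suc m) → Graph (suc m) → ℚ
μ₁ D H = minFin λ v → expect D (λ S → Cdel S H v)

IsMaxCut : ∀ {m} → Graph m → VSubset m → Set
IsMaxCut G S = ∀ T → C T G ℕ.≤ C S G

-- The construction G' from G (G has n = suc k vertices v_1 = zero, ...).
-- Vertices of G' are Fin (suc (n + n)):
--   zero                        ↦ u*
--   suc i, splitAt n i = inj₁ j ↦ v_j   (original vertex)
--   suc i, splitAt n i = inj₂ j ↦ u_j   (new pendant vertex)

data Kind (n : ℕ) : Set where
  star : Kind n
  orig : Fin n → Kind n
  leaf : Fin n → Kind n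

kind : ∀ {n} → Fin (suc (n ℕ.+ n)) → Kind n
kind zero = star
kind {n} (suc i) with splitAt n i
... | inj₁ j = orig j
... | inj₂ j = leaf j

isFirst : ∀ {n} → Fin n → Bool
isFirst zero    = true
isFirst (suc _) = false

adjK : ∀ {n} → (Fin n → Fin n → Bool) → Kind n → Kind n → Bool
adjK a (orig i) (orig j) = a i j
adjK a star     (leaf _) = true
adjK a (leaf _) star     = true
adjK a star     (orig i) = isFirst i
adjK a (orig i) star     = isFirst i
adjK a _        _        = false

adjK-sym : ∀ {n} (a : Fin n → Fin n → Bool) → (∀ x y → a x y ≡ a y x) →
           ∀ k l → adjK a k l ≡ adjK a l k
adjK-sym a s star     star     = refl
adjK-sym a s star     (orig _) = refl
adjK-sym a s star     (leaf _) = refl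
adjK-sym a s (orig _) star     = refl
adjK-sym a s (orig i) (orig j) = s i j
adjK-sym a s (orig _) (leaf _) = refl
adjK-sym a s (leaf _) star     = refl
adjK-sym a s (leaf _) (orig _) = refl
adjK-sym a s (leaf _) (leaf _) = refl

adjK-irr : ∀ {n} (a : Fin n → Fin n → Bool) → (∀ x → a x x ≡ false) →
           ∀ k → adjK a k k ≡ false
adjK-irr a r star     = refl
adjK-irr a r (orig i) = r i
adjK-irr a r (leaf _) = refl

extend : ∀ {n} → Graph n → Graph (suc (n ℕ.+ n))
extend G = record
  { adj    = λ x y → adjK (adj G) (kind x) (kind y)
  ; sym    = λ x y → adjK-sym (adj G) (sym G) (kind x) (kind y)
  ; irrefl = λ x → adjK-irr (adj G) (irrefl G) (kind x)
  }

-- Deleting the hub u* leaves G together with isolated pendant vertices, so every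
-- distribution scores at most a maximum cut of G at v = u*.  Conversely the single set
-- S* ∪ {u*} scores at least C(S*) at every v: at u* it is exactly C(S*), at a pendant
-- vertex the whole cut of G survives, and at an original vertex v_j the at most n cut
-- edges lost at v_j are paid for by the n cut pendant edges u* u_i.
module Submission where

open import Defs
open import Data.Nat using (ℕ; suc; _+_)
open import Data.Rational using (_≤_)
open import Relation.Binary.PropositionalEquality using (_≡_)

open import Data.Bool using (Bool; true; false; _∧_; _xor_; if_then_else_; not)
open import Data.Bool.Properties using (∧-identityʳ; ∧-zeroʳ)
open import Data.Fin using (Fin; zero; suc; toℕ; splitAt; join; _↑ˡ_; _↑ʳ_; _≟_)
open import Data.Fin.Properties
  using (suc-injective; toℕ-↑ˡ; splitAt-↑ˡ; splitAt-↑ʳ; join-splitAt)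
import Data.Integer as ℤ
import Data.Integer.Properties as ℤP
open import Data.List using (List; []; _∷_; foldr)
open import Data.List.Relation.Unary.All using (All; []; _∷_)
import Data.Nat as ℕ
import Data.Nat.Coprimality as Coprime
import Data.Nat.Properties as ℕP
open import Algebra.Properties.CommutativeSemigroup ℕP.+-commutativeSemigroup using (interchange)
open import Data.Product using (_×_; _,_; proj₁; proj₂)
import Data.Rational as ℚ
import Data.Rational.Properties as ℚP
open import Data.Sum using (_⊎_; inj₁; inj₂; [_,_]′)
open import Function using (_∘_)
open import Relation.Binary.PropositionalEquality as ≡
  using (refl; trans; cong; cong₂; subst; subst₂; module ≡-Reasoning)
open import Relation.Nullary.Decidable using (⌊_⌋; ⌊⌋-map′)

⟦_⟧ : Bool → ℕ
⟦ b ⟧ = if b then 1 else 0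

⟦⟧≤1 : ∀ b → ⟦ b ⟧ ℕ.≤ 1
⟦⟧≤1 true  = ℕ.s≤s ℕ.z≤n
⟦⟧≤1 false = ℕ.z≤n

sumFin-cong : ∀ {m} {f g : Fin m → ℕ} → (∀ x → f x ≡ g x) → sumFin f ≡ sumFin g
sumFin-cong {ℕ.zero}  f≗g = refl
sumFin-cong {suc m} f≗g = cong₂ _+_ (f≗g zero) (sumFin-cong (f≗g ∘ suc))

sumFin-mono : ∀ {m} {f g : Fin m → ℕ} → (∀ x → f x ℕ.≤ g x) → sumFin f ℕ.≤ sumFin g
sumFin-mono {ℕ.zero}  f≤g = ℕ.z≤n
sumFin-mono {suc m} f≤g = ℕP.+-mono-≤ (f≤g zero) (sumFin-mono (f≤g ∘ suc))

sumFin-const : ∀ m c → sumFin {m} (λ _ → c) ≡ m ℕ.* c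
sumFin-const ℕ.zero  c = refl
sumFin-const (suc m) c = cong (c +_) (sumFin-const m c)

sumFin-zero : ∀ m → sumFin {m} (λ _ → 0) ≡ 0
sumFin-zero m = trans (sumFin-const m 0) (ℕP.*-zeroʳ m)

sumFin-one : ∀ m → sumFin {m} (λ _ → 1) ≡ m
sumFin-one m = trans (sumFin-const m 1) (ℕP.*-identityʳ m)

sumFin-+ : ∀ {m} (f g : Fin m → ℕ) → sumFin (λ x → f x + g x) ≡ sumFin f + sumFin g
sumFin-+ {ℕ.zero}  f g = refl
sumFin-+ {suc m} f g =
  trans (cong (f zero + g zero +_) (sumFin-+ (f ∘ suc) (g ∘ suc)))
        (interchange (f zero) (g zero) _ _)

sumFin-swap : ∀ {m n} (f : Fin m → Fin n → ℕ) →
              sumFin (λ x → sumFin (f x)) ≡ sumFin (λ y → sumFin (λ x → f x y))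
sumFin-swap {ℕ.zero}  {n} f = ≡.sym (sumFin-zero n)
sumFin-swap {suc m} f = trans (cong (sumFin (f zero) +_) (sumFin-swap (f ∘ suc)))
                              (≡.sym (sumFin-+ (f zero) (λ y → sumFin (λ x → f (suc x) y))))

sumFin-↑ : ∀ m n (f : Fin (m + n) → ℕ) →
           sumFin f ≡ sumFin (λ i → f (i ↑ˡ n)) + sumFin (λ j → f (m ↑ʳ j))
sumFin-↑ ℕ.zero  n f = refl
sumFin-↑ (suc m) n f =
  trans (cong (f zero +_) (sumFin-↑ m n (f ∘ suc))) (≡.sym (ℕP.+-assoc (f zero) _ _))

suc-≟ : ∀ {m} (x y : Fin m) → ⌊ suc x ≟ suc y ⌋ ≡ ⌊ x ≟ y ⌋
suc-≟ x y = ⌊⌋-map′ (cong suc) suc-injective (x ≟ y)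

↑ˡ-≟ : ∀ {m} n (x y : Fin m) → ⌊ x ↑ˡ n ≟ y ↑ˡ n ⌋ ≡ ⌊ x ≟ y ⌋
↑ˡ-≟ n zero    zero    = refl
↑ˡ-≟ n zero    (suc y) = refl
↑ˡ-≟ n (suc x) zero    = refl
↑ˡ-≟ n (suc x) (suc y) =
  trans (suc-≟ (x ↑ˡ n) (y ↑ˡ n)) (trans (↑ˡ-≟ n x y) (≡.sym (suc-≟ x y)))

↑ʳ-≟-↑ˡ : ∀ m {n} (i : Fin n) (j : Fin m) → ⌊ m ↑ʳ i ≟ j ↑ˡ n ⌋ ≡ false
↑ʳ-≟-↑ˡ (suc m) i zero    = refl
↑ʳ-≟-↑ˡ (suc m) i (suc j) = trans (suc-≟ (m ↑ʳ i) (j ↑ˡ _)) (↑ʳ-≟-↑ˡ m i j)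

↑ˡ-≟-↑ʳ : ∀ m {n} (i : Fin n) (j : Fin m) → ⌊ j ↑ˡ n ≟ m ↑ʳ i ⌋ ≡ false
↑ˡ-≟-↑ʳ (suc m) i zero    = refl
↑ˡ-≟-↑ʳ (suc m) i (suc j) = trans (suc-≟ (j ↑ˡ _) (m ↑ʳ i)) (↑ˡ-≟-↑ʳ m i j)

sumFin-δ : ∀ {m} (v : Fin m) (b : Fin m → Bool) → sumFin (λ x → ⟦ ⌊ x ≟ v ⌋ ∧ b x ⟧) ≡ ⟦ b v ⟧
sumFin-δ {suc m} zero    b = trans (cong (⟦ b zero ⟧ +_) (sumFin-zero m)) (ℕP.+-identityʳ _)
sumFin-δ {suc m} (suc v) b =
  trans (sumFin-cong λ x → cong (λ c → ⟦ c ∧ b (suc x) ⟧) (suc-≟ x v)) (sumFin-δ v (b ∘ suc))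

⟦<ᵇ⟧+⟦>ᵇ⟧≤1 : ∀ a b → ⟦ a ℕ.<ᵇ b ⟧ + ⟦ b ℕ.<ᵇ a ⟧ ℕ.≤ 1
⟦<ᵇ⟧+⟦>ᵇ⟧≤1 ℕ.zero    ℕ.zero    = ℕ.z≤n
⟦<ᵇ⟧+⟦>ᵇ⟧≤1 ℕ.zero    (suc b) = ℕ.s≤s ℕ.z≤n
⟦<ᵇ⟧+⟦>ᵇ⟧≤1 (suc a) ℕ.zero    = ℕ.s≤s ℕ.z≤n
⟦<ᵇ⟧+⟦>ᵇ⟧≤1 (suc a) (suc b) = ⟦<ᵇ⟧+⟦>ᵇ⟧≤1 a b

-- ex, ey say whether x, y is the deleted vertex: a cut pair stays cut unless it meets it.
cut≤cutDel+incident : ∀ lt ex ey a sx sy →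
  ⟦ lt ∧ a ∧ (sx xor sy) ⟧ ℕ.≤
  ⟦ lt ∧ not ex ∧ not ey ∧ a ∧ ((sx ∧ not ex) xor (sy ∧ not ey)) ⟧ + (⟦ ex ∧ lt ⟧ + ⟦ ey ∧ lt ⟧)
cut≤cutDel+incident false ex    ey    a sx sy = ℕ.z≤n
cut≤cutDel+incident true  true  ey    a sx sy = ℕP.≤-trans (⟦⟧≤1 _) (ℕ.s≤s ℕ.z≤n)
cut≤cutDel+incident true  false true  a sx sy = ⟦⟧≤1 _
cut≤cutDel+incident true  false false a sx sy
  rewrite ∧-identityʳ sx | ∧-identityʳ sy | ℕP.+-identityʳ ⟦ a ∧ (sx xor sy) ⟧ = ℕP.≤-refl

C≤Cdel+order : ∀ {m} (H : Graph m) (S : VSubset m) (v : Fin m) → C S H ℕ.≤ Cdel S H v + m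
C≤Cdel+order {m} H S v = begin
  C S H
    ≤⟨ sumFin-mono (λ x → sumFin-mono (λ y →
         cut≤cutDel+incident (lt x y) (at x) (at y) (adj H x y) (S x) (S y))) ⟩
  sumFin (λ x → sumFin (λ y → kept x y + (fromTail x y + toHead x y)))
    ≡⟨ sumFin₂-+ kept _ ⟩
  Cdel S H v + sumFin (λ x → sumFin (λ y → fromTail x y + toHead x y))
    ≡⟨ cong (Cdel S H v +_) (trans (sumFin₂-+ fromTail toHead) (cong₂ _+_ tails heads)) ⟩
  Cdel S H v + (sumFin (λ y → ⟦ lt v y ⟧) + sumFin (λ y → ⟦ lt y v ⟧))
    ≡⟨ cong (Cdel S H v +_) (≡.sym (sumFin-+ (λ y → ⟦ lt v y ⟧) (λ y → ⟦ lt y v ⟧))) ⟩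
  Cdel S H v + sumFin (λ y → ⟦ lt v y ⟧ + ⟦ lt y v ⟧)
    ≤⟨ ℕP.+-monoʳ-≤ (Cdel S H v) (sumFin-mono {m} (λ y → ⟦<ᵇ⟧+⟦>ᵇ⟧≤1 (toℕ v) (toℕ y))) ⟩
  Cdel S H v + sumFin {m} (λ _ → 1)
    ≡⟨ cong (Cdel S H v +_) (sumFin-one m) ⟩
  Cdel S H v + m ∎
  where
  open ℕP.≤-Reasoning
  lt : Fin m → Fin m → Bool
  lt x y = toℕ x ℕ.<ᵇ toℕ y
  at : Fin m → Bool
  at x = ⌊ x ≟ v ⌋
  kept fromTail toHead : Fin m → Fin m → ℕ
  kept x y =
    ⟦ lt x y ∧ not (at x) ∧ not (at y) ∧ adj H x y ∧ ((S x ∧ not (at x)) xor (S y ∧ not (at y))) ⟧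
  fromTail x y = ⟦ at x ∧ lt x y ⟧
  toHead x y = ⟦ at y ∧ lt x y ⟧
  sumFin₂-+ : (f g : Fin m → Fin m → ℕ) →
              sumFin (λ x → sumFin (λ y → f x y + g x y)) ≡
              sumFin (λ x → sumFin (f x)) + sumFin (λ x → sumFin (g x))
  sumFin₂-+ f g = trans (sumFin-cong (λ x → sumFin-+ (f x) (g x)))
                        (sumFin-+ (λ x → sumFin (f x)) (λ x → sumFin (g x)))
  tails : sumFin (λ x → sumFin (fromTail x)) ≡ sumFin (λ y → ⟦ lt v y ⟧)
  tails = trans (sumFin-swap fromTail) (sumFin-cong (λ y → sumFin-δ v (λ x → lt x y)))
  heads : sumFin (λ x → sumFin (toHead x)) ≡ sumFin (λ y → ⟦ lt y v ⟧)
  heads = sumFin-cong (λ x → sumFin-δ v (lt x))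

cutTerm : ∀ {m} → Graph m → VSubset m → VSubset m → Fin m → Fin m → ℕ
cutTerm H W S x y = ⟦ (toℕ x ℕ.<ᵇ toℕ y) ∧ W x ∧ W y ∧ adj H x y ∧ (S x xor S y) ⟧

cutTerm-nonadj : ∀ {m} (H : Graph m) (W S : VSubset m) (x y : Fin m) →
                 adj H x y ≡ false → cutTerm H W S x y ≡ 0
cutTerm-nonadj H W S x y x≁y
  rewrite x≁y | ∧-zeroʳ (W y) | ∧-zeroʳ (W x) | ∧-zeroʳ (toℕ x ℕ.<ᵇ toℕ y) = refl

cutIn-cong : ∀ {m} (H : Graph m) {W W′ S S′ : VSubset m} →
             (∀ x → W x ≡ W′ x) → (∀ x → S x ≡ S′ x) → cutIn H W S ≡ cutIn H W′ S′
cutIn-cong H W≗W′ S≗S′ = sumFin-cong λ x → sumFin-cong λ y →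
  cong₂ (λ (wx , wy) (sx , sy) → ⟦ (toℕ x ℕ.<ᵇ toℕ y) ∧ wx ∧ wy ∧ adj H x y ∧ (sx xor sy) ⟧)
        (cong₂ _,_ (W≗W′ x) (W≗W′ y)) (cong₂ _,_ (S≗S′ x) (S≗S′ y))

C-cong : ∀ {m} (H : Graph m) {S S′ : VSubset m} → (∀ x → S x ≡ S′ x) → C S H ≡ C S′ H
C-cong H S≗S′ = cutIn-cong H {W = λ _ → true} (λ _ → refl) S≗S′

Cdel-cong : ∀ {m} (H : Graph m) {S S′ : VSubset m} (v : Fin m) →
            (∀ x → S x ≡ S′ x) → Cdel S H v ≡ Cdel S′ H v
Cdel-cong H v S≗S′ =
  cutIn-cong H {W = λ x → not ⌊ x ≟ v ⌋} (λ _ → refl) (λ x → cong (_∧ _) (S≗S′ x))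

origV leafV : ∀ {n} → Fin n → Fin (suc (n + n))
origV {n} j = suc (j ↑ˡ n)
leafV {n} j = suc (n ↑ʳ j)

Vertex-elim : ∀ {n} (P : Fin (suc (n + n)) → Set) →
              P zero → (∀ j → P (origV j)) → (∀ j → P (leafV j)) → ∀ v → P v
Vertex-elim     P p₀ pₒ pₗ zero    = p₀
Vertex-elim {n} P p₀ pₒ pₗ (suc i) = elim (splitAt n i) (join-splitAt n n i)
  where
  elim : (s : Fin n ⊎ Fin n) → join n n s ≡ i → P (suc i)
  elim (inj₁ j) refl = pₒ j
  elim (inj₂ j) refl = pₗ j

kind-origV : ∀ {n} (j : Fin n) → kind (origV j) ≡ orig j
kind-origV {n} j rewrite splitAt-↑ˡ n j n = refl

kind-leafV : ∀ {n} (j : Fin n) → kind (leafV j) ≡ leaf j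
kind-leafV {n} j rewrite splitAt-↑ʳ n n j = refl

origV-≟ : ∀ {n} (x y : Fin n) → ⌊ origV x ≟ origV y ⌋ ≡ ⌊ x ≟ y ⌋
origV-≟ {n} x y = trans (suc-≟ (x ↑ˡ n) (y ↑ˡ n)) (↑ˡ-≟ n x y)

leafV-≟-origV : ∀ {n} (i j : Fin n) → ⌊ leafV i ≟ origV j ⌋ ≡ false
leafV-≟-origV {n} i j = trans (suc-≟ (n ↑ʳ i) (j ↑ˡ n)) (↑ʳ-≟-↑ˡ n i j)

origV-≟-leafV : ∀ {n} (j i : Fin n) → ⌊ origV j ≟ leafV i ⌋ ≡ false
origV-≟-leafV {n} j i = trans (suc-≟ (j ↑ˡ n) (n ↑ʳ i)) (↑ˡ-≟-↑ʳ n i j)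

withHub : ∀ {n} → VSubset n → VSubset (suc (n + n))
withHub     S zero    = true
withHub {n} S (suc i) = [ S , (λ _ → false) ]′ (splitAt n i)

withHub-origV : ∀ {n} (S : VSubset n) j → withHub S (origV j) ≡ S j
withHub-origV {n} S j rewrite splitAt-↑ˡ n j n = refl

withHub-leafV : ∀ {n} (S : VSubset n) j → withHub S (leafV j) ≡ false
withHub-leafV {n} S j rewrite splitAt-↑ʳ n n j = refl

module _ {n : ℕ} (G : Graph n) where

  private
    G′ : Graph (suc (n + n))
    G′ = extend G

  adj-origV-origV : ∀ i j → adj G′ (origV i) (origV j) ≡ adj G i j
  adj-origV-origV i j = cong₂ (adjK (adj G)) (kind-origV i) (kind-origV j)

  adj-hub-leafV : ∀ j → adj G′ zero (leafV j) ≡ true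
  adj-hub-leafV j = cong (adjK (adj G) star) (kind-leafV j)

  adj-origV-leafV : ∀ i j → adj G′ (origV i) (leafV j) ≡ false
  adj-origV-leafV i j = cong₂ (adjK (adj G)) (kind-origV i) (kind-leafV j)

  adj-leafV-origV : ∀ i j → adj G′ (leafV i) (origV j) ≡ false
  adj-leafV-origV i j = cong₂ (adjK (adj G)) (kind-leafV i) (kind-origV j)

  adj-leafV-leafV : ∀ i j → adj G′ (leafV i) (leafV j) ≡ false
  adj-leafV-leafV i j = cong₂ (adjK (adj G)) (kind-leafV i) (kind-leafV j)

  cutTerm-origV-origV : ∀ W S i j →
    cutTerm G′ W S (origV i) (origV j) ≡ cutTerm G (W ∘ origV) (S ∘ origV) i j
  cutTerm-origV-origV W S i j =
    cong₂ (λ lt a → ⟦ lt ∧ W (origV i) ∧ W (origV j) ∧ a ∧ (S (origV i) xor S (origV j)) ⟧)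
          (cong₂ ℕ._<ᵇ_ (toℕ-↑ˡ i n) (toℕ-↑ˡ j n)) (adj-origV-origV i j)

  row-origV : ∀ W S i →
    sumFin (cutTerm G′ W S (origV i)) ≡ sumFin {n} (cutTerm G (W ∘ origV) (S ∘ origV) i)
  row-origV W S i = begin
    sumFin (cutTerm G′ W S (origV i))
      ≡⟨ sumFin-↑ n n (cutTerm G′ W S (origV i) ∘ suc) ⟩
    sumFin {n} (cutTerm G′ W S (origV i) ∘ origV) + sumFin {n} (cutTerm G′ W S (origV i) ∘ leafV)
      ≡⟨ cong₂ _+_ (sumFin-cong {n} (cutTerm-origV-origV W S i))
                   (trans (sumFin-cong {n} λ j →
                             cutTerm-nonadj G′ W S (origV i) (leafV j) (adj-origV-leafV i j))
                          (sumFin-zero n)) ⟩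
    sumFin {n} (cutTerm G (W ∘ origV) (S ∘ origV) i) + 0
      ≡⟨ ℕP.+-identityʳ _ ⟩
    sumFin {n} (cutTerm G (W ∘ origV) (S ∘ origV) i) ∎
    where open ≡-Reasoning

  row-leafV : ∀ W S i → sumFin (cutTerm G′ W S (leafV i)) ≡ 0
  row-leafV W S i = trans (sumFin-↑ n n (cutTerm G′ W S (leafV i) ∘ suc)) (cong₂ _+_
    (trans (sumFin-cong {n} λ j → cutTerm-nonadj G′ W S (leafV i) (origV j) (adj-leafV-origV i j))
           (sumFin-zero n))
    (trans (sumFin-cong {n} λ j → cutTerm-nonadj G′ W S (leafV i) (leafV j) (adj-leafV-leafV i j))
           (sumFin-zero n)))

  -- Pendant vertices carry no edge other than the one to the hub u* = zero.
  cutIn-extend : ∀ W S →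
    cutIn G′ W S ≡ sumFin (cutTerm G′ W S zero) + cutIn G (W ∘ origV) (S ∘ origV)
  cutIn-extend W S = cong (sumFin (cutTerm G′ W S zero) +_) (begin
    sumFin (λ x → sumFin (cutTerm G′ W S (suc x)))
      ≡⟨ sumFin-↑ n n (λ x → sumFin (cutTerm G′ W S (suc x))) ⟩
    sumFin {n} (λ i → sumFin (cutTerm G′ W S (origV i))) +
    sumFin {n} (λ i → sumFin (cutTerm G′ W S (leafV i)))
      ≡⟨ cong₂ _+_ (sumFin-cong {n} (row-origV W S))
                   (trans (sumFin-cong {n} (row-leafV W S)) (sumFin-zero n)) ⟩
    cutIn G (W ∘ origV) (S ∘ origV) + 0
      ≡⟨ ℕP.+-identityʳ _ ⟩
    cutIn G (W ∘ origV) (S ∘ origV) ∎)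
    where open ≡-Reasoning

  Cdel-hub : ∀ S → Cdel S G′ zero ≡ C (S ∘ origV) G
  Cdel-hub S = begin
    Cdel S G′ zero
      ≡⟨ cutIn-extend W S′ ⟩
    sumFin (cutTerm G′ W S′ zero) + cutIn G (W ∘ origV) (S′ ∘ origV)
      ≡⟨ cong (_+ cutIn G (W ∘ origV) (S′ ∘ origV)) (sumFin-zero (n + n)) ⟩
        -- the row of the deleted hub vanishes by computation, as W zero = false
    cutIn G (W ∘ origV) (S′ ∘ origV)
      ≡⟨ cutIn-cong G {W = W ∘ origV} (λ _ → refl) (λ x → ∧-identityʳ (S (origV x))) ⟩
    C (S ∘ origV) G ∎
    where
    open ≡-Reasoning
    W S′ : VSubset (suc (n + n))
    W x = not ⌊ x ≟ zero ⌋
    S′ x = S x ∧ W x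

  C≤Cdel-leafV : ∀ S j → C (S ∘ origV) G ℕ.≤ Cdel S G′ (leafV j)
  C≤Cdel-leafV S j = begin
    C (S ∘ origV) G
      ≡⟨ ≡.sym (cutIn-cong G kept (λ x → trans (cong (S (origV x) ∧_) (kept x)) (∧-identityʳ _))) ⟩
    cutIn G (W ∘ origV) (S′ ∘ origV)
      ≤⟨ ℕP.m≤n+m _ (sumFin (cutTerm G′ W S′ zero)) ⟩
    sumFin (cutTerm G′ W S′ zero) + cutIn G (W ∘ origV) (S′ ∘ origV)
      ≡⟨ ≡.sym (cutIn-extend W S′) ⟩
    Cdel S G′ (leafV j) ∎
    where
    open ℕP.≤-Reasoning
    W S′ : VSubset (suc (n + n))
    W x = not ⌊ x ≟ leafV j ⌋
    S′ x = S x ∧ W x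
    kept : ∀ x → W (origV x) ≡ true
    kept x = cong not (origV-≟-leafV x j)

  leaves≤hubRow : ∀ W S → sumFin {n} (cutTerm G′ W S zero ∘ leafV) ℕ.≤ sumFin (cutTerm G′ W S zero)
  leaves≤hubRow W S = ℕP.≤-trans (ℕP.m≤n+m _ _)
                                 (ℕP.≤-reflexive (≡.sym (sumFin-↑ n n (cutTerm G′ W S zero ∘ suc))))

  Cdel+leafCut≤Cdel-origV : ∀ S j →
    Cdel (S ∘ origV) G j + sumFin {n} (λ i → ⟦ S zero xor S (leafV i) ⟧) ℕ.≤ Cdel S G′ (origV j)
  Cdel+leafCut≤Cdel-origV S j = begin
    Cdel (S ∘ origV) G j + sumFin {n} (λ i → ⟦ S zero xor S (leafV i) ⟧)
      ≡⟨ ℕP.+-comm (Cdel (S ∘ origV) G j) _ ⟩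
    sumFin {n} (λ i → ⟦ S zero xor S (leafV i) ⟧) + Cdel (S ∘ origV) G j
      ≡⟨ cong₂ _+_ (sumFin-cong {n} hubLeaf)
                   (cutIn-cong G (cong not ∘ orig-≟) λ x →
                      cong (λ b → S (origV x) ∧ not b) (orig-≟ x)) ⟩
    sumFin {n} (cutTerm G′ W S′ zero ∘ leafV) + cutIn G (W ∘ origV) (S′ ∘ origV)
      ≤⟨ ℕP.+-monoˡ-≤ _ (leaves≤hubRow W S′) ⟩
    sumFin (cutTerm G′ W S′ zero) + cutIn G (W ∘ origV) (S′ ∘ origV)
      ≡⟨ ≡.sym (cutIn-extend W S′) ⟩
    Cdel S G′ (origV j) ∎
    where
    open ℕP.≤-Reasoning
    W S′ : VSubset (suc (n + n))
    W x = not ⌊ x ≟ origV j ⌋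
    S′ x = S x ∧ W x
    orig-≟ : ∀ x → ⌊ x ≟ j ⌋ ≡ ⌊ origV x ≟ origV j ⌋
    orig-≟ x = ≡.sym (origV-≟ x j)
    hubLeaf : ∀ i → ⟦ S zero xor S (leafV i) ⟧ ≡ cutTerm G′ W S′ zero (leafV i)
    hubLeaf i = begin-equality
      ⟦ S zero xor S (leafV i) ⟧
        ≡⟨ cong₂ (λ a b → ⟦ a xor b ⟧) (≡.sym (∧-identityʳ (S zero)))
                                        (≡.sym (∧-identityʳ (S (leafV i)))) ⟩
      ⟦ (S zero ∧ true) xor (S (leafV i) ∧ true) ⟧
        ≡⟨ cong₂ (λ w a → ⟦ w ∧ a ∧ ((S zero ∧ true) xor (S (leafV i) ∧ w)) ⟧)
                 (cong not (≡.sym (leafV-≟-origV i j))) (≡.sym (adj-hub-leafV i)) ⟩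
      cutTerm G′ W S′ zero (leafV i) ∎

  C≤Cdel-withHub : ∀ S v → C S G ℕ.≤ Cdel (withHub S) G′ v
  C≤Cdel-withHub S = Vertex-elim (λ v → C S G ℕ.≤ Cdel S⁺ G′ v) atHub atOrig atLeaf
    where
    open ℕP.≤-Reasoning
    S⁺ : VSubset (suc (n + n))
    S⁺ = withHub S
    restrict : ∀ x → S x ≡ S⁺ (origV x)
    restrict x = ≡.sym (withHub-origV S x)
    leafCut : sumFin {n} (λ i → ⟦ S⁺ zero xor S⁺ (leafV i) ⟧) ≡ n
    leafCut = trans (sumFin-cong {n} λ i → cong (λ b → ⟦ true xor b ⟧) (withHub-leafV S i))
                    (sumFin-one n)
    atHub : C S G ℕ.≤ Cdel S⁺ G′ zero
    atHub = ℕP.≤-reflexive (trans (C-cong G restrict) (≡.sym (Cdel-hub S⁺)))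
    atOrig : ∀ j → C S G ℕ.≤ Cdel S⁺ G′ (origV j)
    atOrig j = begin
      C S G
        ≤⟨ C≤Cdel+order G S j ⟩
      Cdel S G j + n
        ≡⟨ cong₂ _+_ (Cdel-cong G j restrict) (≡.sym leafCut) ⟩
      Cdel (S⁺ ∘ origV) G j + sumFin {n} (λ i → ⟦ S⁺ zero xor S⁺ (leafV i) ⟧)
        ≤⟨ Cdel+leafCut≤Cdel-origV S⁺ j ⟩
      Cdel S⁺ G′ (origV j) ∎
    atLeaf : ∀ j → C S G ℕ.≤ Cdel S⁺ G′ (leafV j)
    atLeaf j = ℕP.≤-trans (ℕP.≤-reflexive (C-cong G restrict)) (C≤Cdel-leafV S⁺ j)

toℚ-mono : ∀ {a b} → a ℕ.≤ b → toℚ a ≤ toℚ b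
toℚ-mono {a} {b} a≤b = subst₂ _≤_ (≡.sym (toℚ≡mkℚ a)) (≡.sym (toℚ≡mkℚ b))
  (ℚ.*≤* (subst₂ ℤ._≤_ (≡.sym (ℤP.*-identityʳ (ℤ.+ a))) (≡.sym (ℤP.*-identityʳ (ℤ.+ b)))
                       (ℤ.+≤+ a≤b)))
  where
  toℚ≡mkℚ : ∀ a → toℚ a ≡ ℚ.mkℚ (ℤ.+ a) 0 (Coprime.sym (Coprime.1-coprimeTo a))
  toℚ≡mkℚ a = ℚP.↥p/↧p≡p (ℚ.mkℚ (ℤ.+ a) 0 (Coprime.sym (Coprime.1-coprimeTo a)))

minFin-≤ : ∀ {m} (f : Fin (suc m) → ℚ.ℚ) i → minFin f ≤ f i
minFin-≤ {ℕ.zero}  f zero    = ℚP.≤-refl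
minFin-≤ {suc m} f zero    = ℚP.p⊓q≤p (f zero) _
minFin-≤ {suc m} f (suc i) = ℚP.≤-trans (ℚP.p⊓q≤q (f zero) _) (minFin-≤ (f ∘ suc) i)

minFin-glb : ∀ {m} (f : Fin (suc m) → ℚ.ℚ) {c} → (∀ i → c ≤ f i) → c ≤ minFin f
minFin-glb {ℕ.zero}  f c≤f = c≤f zero
minFin-glb {suc m} f c≤f = ℚP.⊓-glb (c≤f zero) (minFin-glb (f ∘ suc) (c≤f ∘ suc))

module _ {m : ℕ} (f : VSubset m → ℕ) (K : ℕ) (f≤K : ∀ S → f S ℕ.≤ K) where

  weightedSum≤ : (L : List (VSubset m × ℚ.ℚ)) → All (λ p → ℚ.0ℚ ≤ proj₂ p) L →
    foldr (λ p acc → proj₂ p ℚ.* toℚ (f (proj₁ p)) ℚ.+ acc) ℚ.0ℚ L ≤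
    foldr (λ p acc → proj₂ p ℚ.+ acc) ℚ.0ℚ L ℚ.* toℚ K
  weightedSum≤ [] [] = ℚP.≤-reflexive (≡.sym (ℚP.*-zeroˡ (toℚ K)))
  weightedSum≤ ((S , p) ∷ L) (0≤p ∷ 0≤L) = ℚP.≤-trans
    (ℚP.+-mono-≤ (ℚP.*-monoˡ-≤-nonNeg p {{ℚ.nonNegative 0≤p}} (toℚ-mono (f≤K S)))
                 (weightedSum≤ L 0≤L))
    (ℚP.≤-reflexive (≡.sym (ℚP.*-distribʳ-+ (toℚ K) p _)))

  expect-≤ : (D : Distribution m) → expect D f ≤ toℚ K
  expect-≤ D = ℚP.≤-trans (weightedSum≤ (support D) (nonneg D))
    (ℚP.≤-reflexive (trans (cong (ℚ._* toℚ K) (sumToOne D)) (ℚP.*-identityˡ (toℚ K))))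

point : ∀ {m} → VSubset m → Distribution m
point S = record
  { support  = (S , ℚ.1ℚ) ∷ []
  ; nonneg   = ℚ.*≤* (ℤ.+≤+ ℕ.z≤n) ∷ []
  ; sumToOne = ℚP.+-identityʳ ℚ.1ℚ
  }

expect-point : ∀ {m} (S : VSubset m) f → expect (point S) f ≡ toℚ (f S)
expect-point S f = trans (ℚP.+-identityʳ _) (ℚP.*-identityˡ _)

module _ {n : ℕ} (G : Graph n) where

  μ₁-extend-≤-maxCut : ∀ Smc → IsMaxCut G Smc → ∀ D → μ₁ D (extend G) ≤ toℚ (C Smc G)
  μ₁-extend-≤-maxCut Smc maxCut D =
    ℚP.≤-trans (minFin-≤ (λ v → expect D (λ S → Cdel S (extend G) v)) zero)
    (expect-≤ (λ S → Cdel S (extend G) zero) (C Smc G)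
              (λ S → subst (ℕ._≤ C Smc G) (≡.sym (Cdel-hub G S)) (maxCut (S ∘ origV))) D)

  C≤μ₁-point-withHub : ∀ S → toℚ (C S G) ≤ μ₁ (point (withHub S)) (extend G)
  C≤μ₁-point-withHub S = minFin-glb _ λ v →
    subst (toℚ (C S G) ≤_) (≡.sym (expect-point (withHub S) (λ T → Cdel T (extend G) v)))
          (toℚ-mono (C≤Cdel-withHub G S v))

lemma33 : (k : ℕ) (G : Graph (suc k)) (Dstar : Distribution (suc (suc k + suc k)))
          → (∀ D → μ₁ D (extend G) ≤ μ₁ Dstar (extend G))
          → (Smc : VSubset (suc k)) → IsMaxCut G Smc
          → μ₁ Dstar (extend G) ≡ toℚ (C Smc G)
lemma33 k G Dstar optimal Smc maxCut = ℚP.≤-antisym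
  (μ₁-extend-≤-maxCut G Smc maxCut Dstar)
  (ℚP.≤-trans (C≤μ₁-point-withHub G Smc) (optimal (point (withHub Smc))))
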